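{- For every nonnegative integer $n$, $$\sum_{k=0}^{\lfloor n/2\rfloor}\binom{2k}k^2\binom{3k}k\binom{n+k}{3k}4^{n-2k} =\sum_{k=0}^n\binom{2k}k\binom{2n-2k}{n-k}\binom nk^2.$$
   Context: $\lfloor x\rfloor$ is the greatest integer not exceeding $x$. -}

module Defs where

open import Data.Nat using (ℕ; zero; suc; _+_)

sumTo : ℕ → (ℕ → ℕ) → ℕ
sumTo zero    f = f zero
sumTo (suc n) f = sumTo n f + f (suc n)

-- Both sides are row sums S(n) = Σₖ F(n,k) of hypergeometric terms F, and for each of them
-- Zeilberger's algorithm yields a certificate showing that S satisfies
--   64 (n+1)³ S(n) − 2 (2n+3)(5n²+15n+12) S(n+1) + (n+2)³ S(n+2) = 0:
-- with Δ(n,k) the same combination of F(n,k), F(n+1,k), F(n+2,k), the partial sums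
-- Σ_{j<k} Δ(n,j) equal G(n,k) = A(n,k) F(n+2,k) / D(n,k) for explicit polynomials A, D.
-- Induction on k reduces this, through the rational quotients F(n+1,k) / F(n,k) and
-- F(n,k+1) / F(n,k), to one polynomial identity, and k = n + 3, past the support of
-- F(n+2,·), gives the recurrence. The two sides agree at n = 0 and n = 1, and (n+2)³ ≠ 0,
-- so they agree for every n.

module Submission where

open import Agda.Builtin.FromNat using (Number; fromNat)
open import Data.Nat using (ℕ; zero; suc; _<_; _≤_; _∸_; _^_; _/_; s≤s; z≤n)
open import Data.Nat.Combinatorics using (_C_; nCk+nC[k+1]≡[n+1]C[k+1]; k>n⇒nCk≡0; nC1≡n)
open import Data.Nat.DivMod using (m≡m%n+[m/n]*n; m%n<n; m/n≤m)
import Data.Nat.Properties as ℕ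
open import Data.Product using (_,_; _×_; proj₁)
open import Data.Unit using (tt)
open import Relation.Binary.PropositionalEquality
open import Defs

module _ where

  open import Data.Integer using (ℤ; +_; 0ℤ; _+_; _-_; _*_; -_; ∣_∣; ≢-nonZero)
  open import Data.Integer.Properties
    using (*-cancelˡ-≡; *-zeroʳ; *-zeroˡ; *-identityˡ; *-assoc; +-identityʳ; i*j≡0⇒i≡0∨j≡0; abs-*; pos-*; m-n≡m⊖n; ⊖-≥)
  open import Data.Integer.Tactic.RingSolver using (solve-∀; solve)
  import Data.Integer.Literals as ℤ-Literals
  open import Data.List using (_∷_; [])
  import Data.Nat as ℕ
  import Data.Nat.Literals as ℕ-Literals
  open import Data.Sum using ([_,_]′)
  open import Function using (_$_)
  open import Relation.Binary.Definitions using (tri<; tri≈; tri>)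
  open import Relation.Nullary using (yes; no)

  instance
    ℤ-number : Number ℤ
    ℤ-number = ℤ-Literals.number
    ℕ-number : Number ℕ
    ℕ-number = ℕ-Literals.number

  *-cancelˡ-≢0 : ∀ i {j k} → i ≢ 0ℤ → i * j ≡ i * k → j ≡ k
  *-cancelˡ-≢0 i {j} {k} i≢0 = *-cancelˡ-≡ i j k {{≢-nonZero i≢0}}

  *-≢0 : ∀ {i j} → i ≢ 0ℤ → j ≢ 0ℤ → i * j ≢ 0ℤ
  *-≢0 {i} i≢0 j≢0 ij≡0 = [ i≢0 , j≢0 ]′ (i*j≡0⇒i≡0∨j≡0 i ij≡0)

  +[1+]≢0 : ∀ n → + suc n ≢ 0ℤ
  +[1+]≢0 n ()

  odd-≢0 : ∀ i → 1 + 2 * i ≢ 0ℤ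
  odd-≢0 i 1+2i≡0 with ℕ.m*n≡1⇒m≡1 2 ∣ i ∣ 2∣i∣≡1
    where
    2∣i∣≡1 : 2 ℕ.* ∣ i ∣ ≡ 1
    2∣i∣≡1 = begin
      2 ℕ.* ∣ i ∣        ≡⟨ sym (abs-* 2 i) ⟩
      ∣ 2 * i ∣          ≡⟨ cong ∣_∣ (2i≡1+2i-1 i) ⟩
      ∣ 1 + 2 * i - 1 ∣  ≡⟨ cong (λ x → ∣ x - 1 ∣) 1+2i≡0 ⟩
      1                  ∎
      where
      open ≡-Reasoning
      2i≡1+2i-1 : ∀ i → 2 * i ≡ 1 + 2 * i - 1
      2i≡1+2i-1 = solve-∀
  ... | ()

  both-vanish : ∀ a b {X Y} → X ≡ 0ℤ → Y ≡ 0ℤ → a * X ≡ b * Y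
  both-vanish a b refl refl = trans (*-zeroʳ a) (sym (*-zeroʳ b))

  vanish-with-coefficient : ∀ a {b X} Y → X ≡ 0ℤ → b ≡ 0ℤ → a * X ≡ b * Y
  vanish-with-coefficient a Y refl refl = trans (*-zeroʳ a) (sym (*-zeroˡ Y))

  +[1+a]+c*k≢0 : ∀ a c k → + suc a + + c * + k ≢ 0ℤ
  +[1+a]+c*k≢0 a c k = subst (λ x → + suc a + x ≢ 0ℤ) (pos-* c k) (+[1+]≢0 (a ℕ.+ c ℕ.* k))

  scale-by : ∀ g m l {A P A′ d} → m * A + P ≡ l * A′ * d → m * g * A + g * P ≡ l * (g * A′) * d
  scale-by g m l {A} {P} {A′} {d} mA+P≡lA′d = begin
    m * g * A + g * P     ≡⟨ solve (g ∷ m ∷ A ∷ P ∷ []) ⟩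
    g * (m * A + P)       ≡⟨ cong (g *_) mA+P≡lA′d ⟩
    g * (l * A′ * d)      ≡⟨ solve (g ∷ l ∷ A′ ∷ d ∷ []) ⟩
    l * (g * A′) * d      ∎
    where open ≡-Reasoning

  ratio-* : ∀ x y u v {X Y U V} → x * X ≡ y * Y → u * U ≡ v * V → x * u * (X * U) ≡ y * v * (Y * V)
  ratio-* x y u v {X} {Y} {U} {V} xX≡yY uU≡vV = begin
    x * u * (X * U)     ≡⟨ solve (x ∷ u ∷ X ∷ U ∷ []) ⟩
    (x * X) * (u * U)   ≡⟨ cong₂ _*_ xX≡yY uU≡vV ⟩
    (y * Y) * (v * V)   ≡⟨ solve (y ∷ v ∷ Y ∷ V ∷ []) ⟩
    y * v * (Y * V)     ∎
    where open ≡-Reasoning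

  common-factor : ∀ z x y {X Y} → x * X ≡ y * Y → x * (z * X) ≡ y * (z * Y)
  common-factor z x y {X} {Y} xX≡yY = begin
    x * (z * X) ≡⟨ solve (x ∷ z ∷ X ∷ []) ⟩
    z * (x * X) ≡⟨ cong (z *_) xX≡yY ⟩
    z * (y * Y) ≡⟨ solve (y ∷ z ∷ Y ∷ []) ⟩
    y * (z * Y) ∎
    where open ≡-Reasoning

  psum : ℕ → (ℕ → ℤ) → ℤ
  psum zero    f = 0ℤ
  psum (suc k) f = psum k f + f k

  psum-extend : ∀ j a (f : ℕ → ℤ) → (∀ i → f (i ℕ.+ a) ≡ 0ℤ) → psum (j ℕ.+ a) f ≡ psum a f
  psum-extend zero    a f f≡0 = refl
  psum-extend (suc j) a f f≡0 = begin
    psum (j ℕ.+ a) f + f (j ℕ.+ a) ≡⟨ cong₂ _+_ (psum-extend j a f f≡0) (f≡0 j) ⟩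
    psum a f + 0ℤ                  ≡⟨ +-identityʳ (psum a f) ⟩
    psum a f                       ∎
    where open ≡-Reasoning

  psum-linear : ∀ m x y z (f g h : ℕ → ℤ) →
    psum m (λ k → x * f k + y * g k + z * h k) ≡ x * psum m f + y * psum m g + z * psum m h
  psum-linear zero    x y z f g h = solve (x ∷ y ∷ z ∷ [])
  psum-linear (suc m) x y z f g h = begin
    psum m (λ k → x * f k + y * g k + z * h k) + (x * f m + y * g m + z * h m)
      ≡⟨ cong (_+ (x * f m + y * g m + z * h m)) (psum-linear m x y z f g h) ⟩
    x * psum m f + y * psum m g + z * psum m h + (x * f m + y * g m + z * h m)
      ≡⟨ regroup x y z (psum m f) (psum m g) (psum m h) (f m) (g m) (h m) ⟩
    x * (psum m f + f m) + y * (psum m g + g m) + z * (psum m h + h m) ∎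
    where
    open ≡-Reasoning
    regroup : ∀ x y z a b c a′ b′ c′ →
      x * a + y * b + z * c + (x * a′ + y * b′ + z * c′) ≡ x * (a + a′) + y * (b + b′) + z * (c + c′)
    regroup = solve-∀

  telescoping-step : ∀ p₀ p₁ p₂ a₀ b₀ a₁ b₁ c d D D′ A A′ l₁ l₂ l₃ {G F₀ F₁ E E₁ : ℤ} →
    a₀ * a₁ * l₁ ≡ c * D′ * l₂ → a₀ * a₁ * l₁ ≡ D * l₃ →
    l₃ * A + l₁ * (p₀ * b₀ * b₁ + p₁ * a₀ * b₁ + p₂ * a₀ * a₁) ≡ l₂ * A′ * d →
    a₀ * F₀ ≡ b₀ * F₁ → a₁ * F₁ ≡ b₁ * E → c * E₁ ≡ d * E → D * G ≡ A * E →
    a₀ * a₁ * l₁ * (D′ * (G + (p₀ * F₀ + p₁ * F₁ + p₂ * E))) ≡ a₀ * a₁ * l₁ * (A′ * E₁)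
  telescoping-step p₀ p₁ p₂ a₀ b₀ a₁ b₁ c d D D′ A A′ l₁ l₂ l₃ {G} {F₀} {F₁} {E} {E₁}
    L≡cD′l₂ L≡Dl₃ certificate F₀→F₁ F₁→E E→E₁ DG≡AE = begin
    a₀ * a₁ * l₁ * (D′ * (G + (p₀ * F₀ + p₁ * F₁ + p₂ * E)))
      ≡⟨ solve (a₀ ∷ a₁ ∷ l₁ ∷ D′ ∷ G ∷ p₀ ∷ F₀ ∷ p₁ ∷ F₁ ∷ p₂ ∷ E ∷ []) ⟩
    D′ * (a₀ * a₁ * l₁ * G) + D′ * l₁ * (p₀ * a₁ * (a₀ * F₀) + p₁ * a₀ * (a₁ * F₁) + p₂ * a₀ * a₁ * E)
      ≡⟨ cong₂ (λ x y → D′ * (x * G) + D′ * l₁ * (p₀ * a₁ * y + p₁ * a₀ * (a₁ * F₁) + p₂ * a₀ * a₁ * E))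
               L≡Dl₃ F₀→F₁ ⟩
    D′ * (D * l₃ * G) + D′ * l₁ * (p₀ * a₁ * (b₀ * F₁) + p₁ * a₀ * (a₁ * F₁) + p₂ * a₀ * a₁ * E)
      ≡⟨ solve (D′ ∷ D ∷ l₃ ∷ G ∷ l₁ ∷ p₀ ∷ a₁ ∷ b₀ ∷ F₁ ∷ p₁ ∷ a₀ ∷ p₂ ∷ E ∷ []) ⟩
    D′ * l₃ * (D * G) + D′ * l₁ * ((p₀ * b₀ + p₁ * a₀) * (a₁ * F₁) + p₂ * a₀ * a₁ * E)
      ≡⟨ cong₂ (λ x y → D′ * l₃ * x + D′ * l₁ * ((p₀ * b₀ + p₁ * a₀) * y + p₂ * a₀ * a₁ * E)) DG≡AE F₁→E ⟩
    D′ * l₃ * (A * E) + D′ * l₁ * ((p₀ * b₀ + p₁ * a₀) * (b₁ * E) + p₂ * a₀ * a₁ * E)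
      ≡⟨ solve (D′ ∷ l₃ ∷ A ∷ E ∷ l₁ ∷ p₀ ∷ b₀ ∷ p₁ ∷ a₀ ∷ b₁ ∷ p₂ ∷ a₁ ∷ []) ⟩
    D′ * E * (l₃ * A + l₁ * (p₀ * b₀ * b₁ + p₁ * a₀ * b₁ + p₂ * a₀ * a₁))
      ≡⟨ cong (D′ * E *_) certificate ⟩
    D′ * E * (l₂ * A′ * d)
      ≡⟨ solve (D′ ∷ E ∷ l₂ ∷ A′ ∷ d ∷ []) ⟩
    D′ * l₂ * A′ * (d * E)
      ≡⟨ cong (D′ * l₂ * A′ *_) (sym E→E₁) ⟩
    D′ * l₂ * A′ * (c * E₁)
      ≡⟨ solve (D′ ∷ l₂ ∷ A′ ∷ c ∷ E₁ ∷ []) ⟩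
    c * D′ * l₂ * (A′ * E₁)
      ≡⟨ cong (_* (A′ * E₁)) (sym L≡cD′l₂) ⟩
    a₀ * a₁ * l₁ * (A′ * E₁) ∎
    where open ≡-Reasoning

  module SecondOrderRecurrence (p₀ p₁ p₂ : ℤ → ℤ) where

    IsSolution : (ℕ → ℤ) → Set
    IsSolution u = ∀ n → p₀ (+ n) * u n + p₁ (+ n) * u (suc n) + p₂ (+ n) * u (2 ℕ.+ n) ≡ 0ℤ

    solutions-agree : (∀ n → p₂ (+ n) ≢ 0ℤ) → ∀ {u v} → IsSolution u → IsSolution v →
                      u 0 ≡ v 0 → u 1 ≡ v 1 → ∀ n → u n ≡ v n
    solutions-agree p₂≢0 {u} {v} u-sol v-sol u₀≡v₀ u₁≡v₁ n = proj₁ (consecutive n)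
      where
      consecutive : ∀ n → u n ≡ v n × u (suc n) ≡ v (suc n)
      consecutive zero    = u₀≡v₀ , u₁≡v₁
      consecutive (suc n) with consecutive n
      ... | uₙ≡vₙ , uₙ₊₁≡vₙ₊₁ = uₙ₊₁≡vₙ₊₁ , *-cancelˡ-≢0 (p₂ (+ n)) (p₂≢0 n) (begin
        p₂ (+ n) * u (2 ℕ.+ n)                      ≡⟨ last-term (p₀ (+ n) * u n) (p₁ (+ n) * u (suc n)) _ (u-sol n) ⟩
        - (p₀ (+ n) * u n + p₁ (+ n) * u (suc n))   ≡⟨ cong₂ (λ x y → - (p₀ (+ n) * x + p₁ (+ n) * y)) uₙ≡vₙ uₙ₊₁≡vₙ₊₁ ⟩
        - (p₀ (+ n) * v n + p₁ (+ n) * v (suc n))   ≡⟨ sym (last-term (p₀ (+ n) * v n) (p₁ (+ n) * v (suc n)) _ (v-sol n)) ⟩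
        p₂ (+ n) * v (2 ℕ.+ n)                      ∎)
        where
        open ≡-Reasoning
        last-term : ∀ x y z → x + y + z ≡ 0ℤ → z ≡ - (x + y)
        last-term x y z x+y+z≡0 = begin
          z                   ≡⟨ solve (x ∷ y ∷ z ∷ []) ⟩
          x + y + z - (x + y) ≡⟨ cong (_- (x + y)) x+y+z≡0 ⟩
          0ℤ - (x + y)        ≡⟨ solve (x ∷ y ∷ []) ⟩
          - (x + y)           ∎

    -- F(n+1,k) / F(n,k) = a/b and F(n,k+1) / F(n,k) = d/c; the certificate is
    -- G(n,k) = A(n,k) F(n+2,k) / D(n,k), and a(n,k) a(n+1,k) l₁(n,k) is a common multiple of
    -- the denominators in G(n,k+1) − G(n,k) = Δ(n,k), with cofactors l₂ and l₃.
    module CreativeTelescoping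
      (F : ℕ → ℕ → ℤ)
      (a b c d D A l₁ l₂ l₃ : ℤ → ℤ → ℤ)
      (F-shiftₙ : ∀ n k → a (+ n) (+ k) * F n k ≡ b (+ n) (+ k) * F (suc n) k)
      (F-shiftₖ : ∀ n k → c (+ n) (+ k) * F n (suc k) ≡ d (+ n) (+ k) * F n k)
      (F-vanishes : ∀ n k → n < k → F n k ≡ 0ℤ)
      (common-multiple : ∀ N K →
        (a N K * a (1 + N) K * l₁ N K ≡ c (2 + N) K * D N (1 + K) * l₂ N K) ×
        (a N K * a (1 + N) K * l₁ N K ≡ D N K * l₃ N K))
      (certificate : ∀ N K →
        l₃ N K * A N K + l₁ N K * (p₀ N * b N K * b (1 + N) K + p₁ N * a N K * b (1 + N) K + p₂ N * a N K * a (1 + N) K)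
          ≡ l₂ N K * A N (1 + K) * d (2 + N) K)
      (A-vanishes : ∀ N → A N 0ℤ ≡ 0ℤ)
      (a≢0 : ∀ n k → a (+ n) (+ k) ≢ 0ℤ)
      (l₁≢0 : ∀ n k → l₁ (+ n) (+ k) ≢ 0ℤ)
      (D≢0 : ∀ n → D (+ n) (+ (3 ℕ.+ n)) ≢ 0ℤ)
      where

      Δ : ℕ → ℕ → ℤ
      Δ n k = p₀ (+ n) * F n k + p₁ (+ n) * F (suc n) k + p₂ (+ n) * F (2 ℕ.+ n) k

      telescoping : ∀ n k → D (+ n) (+ k) * psum k (Δ n) ≡ A (+ n) (+ k) * F (2 ℕ.+ n) k
      telescoping n zero = begin
        D (+ n) 0ℤ * 0ℤ            ≡⟨ *-zeroʳ (D (+ n) 0ℤ) ⟩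
        0ℤ                         ≡⟨ sym (*-zeroˡ (F (2 ℕ.+ n) 0)) ⟩
        0ℤ * F (2 ℕ.+ n) 0         ≡⟨ cong (_* F (2 ℕ.+ n) 0) (sym (A-vanishes (+ n))) ⟩
        A (+ n) 0ℤ * F (2 ℕ.+ n) 0 ∎
        where open ≡-Reasoning
      telescoping n (suc k) with common-multiple (+ n) (+ k)
      ... | L≡cD′l₂ , L≡Dl₃ = *-cancelˡ-≢0 (a N K * a (1 + N) K * l₁ N K)
        (*-≢0 (*-≢0 (a≢0 n k) (a≢0 (suc n) k)) (l₁≢0 n k))
        (telescoping-step (p₀ N) (p₁ N) (p₂ N) (a N K) (b N K) (a (1 + N) K) (b (1 + N) K)
           (c (2 + N) K) (d (2 + N) K) (D N K) (D N (1 + K)) (A N K) (A N (1 + K)) (l₁ N K) (l₂ N K) (l₃ N K)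
           L≡cD′l₂ L≡Dl₃ (certificate N K) (F-shiftₙ n k) (F-shiftₙ (suc n) k) (F-shiftₖ (2 ℕ.+ n) k) (telescoping n k))
        where
        N = + n
        K = + k

      rowSum : ℕ → ℤ
      rowSum n = psum (suc n) (F n)

      rowSum-isSolution : IsSolution rowSum
      rowSum-isSolution n = begin
        p₀ (+ n) * rowSum n + p₁ (+ n) * rowSum (suc n) + p₂ (+ n) * rowSum (2 ℕ.+ n)
          ≡⟨ cong₂ (λ x y → p₀ (+ n) * x + p₁ (+ n) * y + p₂ (+ n) * rowSum (2 ℕ.+ n))
               (sym (psum-extend 2 (suc n) (F n) (F-vanishes-beyond n)))
               (sym (psum-extend 1 (2 ℕ.+ n) (F (suc n)) (F-vanishes-beyond (suc n)))) ⟩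
        p₀ (+ n) * psum K (F n) + p₁ (+ n) * psum K (F (suc n)) + p₂ (+ n) * psum K (F (2 ℕ.+ n))
          ≡⟨ sym (psum-linear K (p₀ (+ n)) (p₁ (+ n)) (p₂ (+ n)) (F n) (F (suc n)) (F (2 ℕ.+ n))) ⟩
        psum K (Δ n)
          ≡⟨ *-cancelˡ-≢0 (D (+ n) (+ K)) (D≢0 n) (begin
               D (+ n) (+ K) * psum K (Δ n)   ≡⟨ telescoping n K ⟩
               A (+ n) (+ K) * F (2 ℕ.+ n) K  ≡⟨ cong (A (+ n) (+ K) *_) (F-vanishes (2 ℕ.+ n) K (ℕ.n<1+n _)) ⟩
               A (+ n) (+ K) * 0ℤ             ≡⟨ *-zeroʳ (A (+ n) (+ K)) ⟩
               0ℤ                             ≡⟨ sym (*-zeroʳ (D (+ n) (+ K))) ⟩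
               D (+ n) (+ K) * 0ℤ             ∎) ⟩
        0ℤ ∎
        where
        open ≡-Reasoning
        K = 3 ℕ.+ n
        F-vanishes-beyond : ∀ m i → F m (i ℕ.+ suc m) ≡ 0ℤ
        F-vanishes-beyond m i = F-vanishes m (i ℕ.+ suc m) (ℕ.m≤n+m (suc m) i)

  binom : ℕ → ℕ → ℤ
  binom n k = + (n C k)

  binom-vanishes : ∀ {n k} → n < k → binom n k ≡ 0ℤ
  binom-vanishes n<k = cong +_ (k>n⇒nCk≡0 n<k)

  binom-pascal : ∀ n k → binom (suc n) (suc k) ≡ binom n k + binom n (suc k)
  binom-pascal n k = cong +_ (sym (nCk+nC[k+1]≡[n+1]C[k+1] n k))

  binom-absorption : ∀ n k → (1 + + k) * binom (suc n) (suc k) ≡ (1 + + n) * binom n k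
  binom-absorption zero    zero    = refl
  binom-absorption zero    (suc k) = begin
    (2 + + k) * binom 1 (2 ℕ.+ k) ≡⟨ cong ((2 + + k) *_) (binom-vanishes {1} {2 ℕ.+ k} (s≤s (s≤s z≤n))) ⟩
    (2 + + k) * 0ℤ                ≡⟨ *-zeroʳ (2 + + k) ⟩
    0ℤ                            ≡⟨ sym (binom-vanishes {0} {suc k} (s≤s z≤n)) ⟩
    binom 0 (suc k)               ≡⟨ sym (*-identityˡ _) ⟩
    1 * binom 0 (suc k)           ∎
    where open ≡-Reasoning
  binom-absorption (suc n) zero    = begin
    1 * binom (2 ℕ.+ n) 1        ≡⟨ cong (λ m → 1 * + m) (nC1≡n (2 ℕ.+ n)) ⟩
    1 * (2 + + n)                ≡⟨ 1*[2+N]≡[2+N]*1 (+ n) ⟩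
    (2 + + n) * 1                ∎
    where
    open ≡-Reasoning
    1*[2+N]≡[2+N]*1 : ∀ N → 1 * (2 + N) ≡ (2 + N) * 1
    1*[2+N]≡[2+N]*1 = solve-∀
  binom-absorption (suc n) (suc k) = absorption-step (+ n) (+ k)
    (binom-pascal (suc n) (suc k)) (binom-pascal n k)
    (binom-absorption n k) (binom-absorption n (suc k))
    where
    absorption-step : ∀ N K {B₁ B₂ B₃ B₄ B₅} → B₁ ≡ B₂ + B₃ → B₂ ≡ B₄ + B₅ →
      (1 + K) * B₂ ≡ (1 + N) * B₄ → (2 + K) * B₃ ≡ (1 + N) * B₅ → (2 + K) * B₁ ≡ (2 + N) * B₂
    absorption-step N K {B₂ = B₂} {B₃} {B₄} {B₅} refl B₂≡B₄+B₅ h₁ h₂ = begin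
      (2 + K) * (B₂ + B₃)                     ≡⟨ solve (K ∷ B₂ ∷ B₃ ∷ []) ⟩
      B₂ + (1 + K) * B₂ + (2 + K) * B₃        ≡⟨ cong₂ (λ x y → B₂ + x + y) h₁ h₂ ⟩
      B₂ + (1 + N) * B₄ + (1 + N) * B₅        ≡⟨ solve (N ∷ B₂ ∷ B₄ ∷ B₅ ∷ []) ⟩
      B₂ + (1 + N) * (B₄ + B₅)                ≡⟨ cong (λ x → B₂ + (1 + N) * x) (sym B₂≡B₄+B₅) ⟩
      B₂ + (1 + N) * B₂                       ≡⟨ solve (N ∷ B₂ ∷ []) ⟩
      (2 + N) * B₂                            ∎
      where open ≡-Reasoning

  binom-suc-lower : ∀ n k → (1 + + k) * binom n (suc k) ≡ (+ n - + k) * binom n k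
  binom-suc-lower n k = combine (+ n) (+ k) (binom-pascal n k) (binom-absorption n k)
    where
    combine : ∀ N K {B₁ B₂ B₃} → B₁ ≡ B₂ + B₃ → (1 + K) * B₁ ≡ (1 + N) * B₂ → (1 + K) * B₃ ≡ (N - K) * B₂
    combine N K {B₂ = B₂} {B₃} refl h = begin
      (1 + K) * B₃                          ≡⟨ solve (K ∷ B₂ ∷ B₃ ∷ []) ⟩
      (1 + K) * (B₂ + B₃) - (1 + K) * B₂    ≡⟨ cong (_- (1 + K) * B₂) h ⟩
      (1 + N) * B₂ - (1 + K) * B₂           ≡⟨ solve (N ∷ K ∷ B₂ ∷ []) ⟩
      (N - K) * B₂                          ∎
      where open ≡-Reasoning

  binom-suc-upper : ∀ n k → (1 + + n - + k) * binom (suc n) k ≡ (1 + + n) * binom n k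
  binom-suc-upper n zero    = [1+N-0]*1≡[1+N]*1 (+ n)
    where
    [1+N-0]*1≡[1+N]*1 : ∀ N → (1 + N - 0ℤ) * 1 ≡ (1 + N) * 1
    [1+N-0]*1≡[1+N]*1 = solve-∀
  binom-suc-upper n (suc k) = combine (+ n) (+ k) (binom-pascal n k) (binom-suc-lower n k)
    where
    combine : ∀ N K {B₁ B₂ B₃} → B₁ ≡ B₂ + B₃ → (1 + K) * B₃ ≡ (N - K) * B₂ →
              (1 + N - (1 + K)) * B₁ ≡ (1 + N) * B₃
    combine N K {B₂ = B₂} {B₃} refl h = begin
      (1 + N - (1 + K)) * (B₂ + B₃)         ≡⟨ solve (N ∷ K ∷ B₂ ∷ B₃ ∷ []) ⟩
      (N - K) * B₂ + (N - K) * B₃           ≡⟨ cong (_+ (N - K) * B₃) (sym h) ⟩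
      (1 + K) * B₃ + (N - K) * B₃           ≡⟨ solve (N ∷ K ∷ B₃ ∷ []) ⟩
      (1 + N) * B₃                          ∎
      where open ≡-Reasoning

  central : ℕ → ℤ
  central k = binom (2 ℕ.* k) k

  central-suc : ∀ k → (1 + + k) * central (suc k) ≡ 2 * (1 + 2 * + k) * central k
  central-suc k =
    subst (λ m → (1 + + k) * binom m (suc k) ≡ 2 * (1 + 2 * + k) * binom (2 ℕ.* k) k) (sym (ℕ.*-suc 2 k)) $
    combine (+ k) (pos-* 2 k) (binom-absorption (suc (2 ℕ.* k)) k) (binom-suc-upper (2 ℕ.* k) k)
    where
    combine : ∀ K {T C₁ B C₀} → T ≡ 2 * K → (1 + K) * C₁ ≡ (1 + (1 + T)) * B →
              (1 + T - K) * B ≡ (1 + T) * C₀ → (1 + K) * C₁ ≡ 2 * (1 + 2 * K) * C₀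
    combine K {C₁ = C₁} {B} {C₀} refl h₁ h₂ = begin
      (1 + K) * C₁                    ≡⟨ h₁ ⟩
      (1 + (1 + 2 * K)) * B           ≡⟨ solve (K ∷ B ∷ []) ⟩
      2 * ((1 + 2 * K - K) * B)       ≡⟨ cong (2 *_) h₂ ⟩
      2 * ((1 + 2 * K) * C₀)          ≡⟨ solve (K ∷ C₀ ∷ []) ⟩
      2 * (1 + 2 * K) * C₀            ∎
      where open ≡-Reasoning

  binom-3k-k-suc : ∀ k → (1 + + k) * (2 + 2 * + k) * (1 + 2 * + k) * binom (3 ℕ.* suc k) (suc k)
                       ≡ (3 + 3 * + k) * (2 + 3 * + k) * (1 + 3 * + k) * binom (3 ℕ.* k) k
  binom-3k-k-suc k =
    subst (λ m → (1 + + k) * (2 + 2 * + k) * (1 + 2 * + k) * binom m (suc k)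
               ≡ (3 + 3 * + k) * (2 + 3 * + k) * (1 + 3 * + k) * binom (3 ℕ.* k) k) (sym (ℕ.*-suc 3 k)) $
    combine (+ k) (pos-* 3 k) (binom-absorption (2 ℕ.+ 3 ℕ.* k) k)
      (binom-suc-upper (suc (3 ℕ.* k)) k) (binom-suc-upper (3 ℕ.* k) k)
    where
    combine : ∀ K {T C₃ C₂ C₁ C₀} → T ≡ 3 * K → (1 + K) * C₃ ≡ (1 + (2 + T)) * C₂ →
      (1 + (1 + T) - K) * C₂ ≡ (1 + (1 + T)) * C₁ → (1 + T - K) * C₁ ≡ (1 + T) * C₀ →
      (1 + K) * (2 + 2 * K) * (1 + 2 * K) * C₃ ≡ (3 + 3 * K) * (2 + 3 * K) * (1 + 3 * K) * C₀
    combine K {C₃ = C₃} {C₂} {C₁} {C₀} refl h₃ h₂ h₁ = begin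
      (1 + K) * (2 + 2 * K) * (1 + 2 * K) * C₃                  ≡⟨ solve (K ∷ C₃ ∷ []) ⟩
      (2 + 2 * K) * (1 + 2 * K) * ((1 + K) * C₃)                ≡⟨ cong ((2 + 2 * K) * (1 + 2 * K) *_) h₃ ⟩
      (2 + 2 * K) * (1 + 2 * K) * ((1 + (2 + 3 * K)) * C₂)      ≡⟨ solve (K ∷ C₂ ∷ []) ⟩
      (3 + 3 * K) * (1 + 2 * K) * ((1 + (1 + 3 * K) - K) * C₂)  ≡⟨ cong ((3 + 3 * K) * (1 + 2 * K) *_) h₂ ⟩
      (3 + 3 * K) * (1 + 2 * K) * ((1 + (1 + 3 * K)) * C₁)      ≡⟨ solve (K ∷ C₁ ∷ []) ⟩
      (3 + 3 * K) * (2 + 3 * K) * ((1 + 3 * K - K) * C₁)        ≡⟨ cong ((3 + 3 * K) * (2 + 3 * K) *_) h₁ ⟩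
      (3 + 3 * K) * (2 + 3 * K) * ((1 + 3 * K) * C₀)            ≡⟨ solve (K ∷ C₀ ∷ []) ⟩
      (3 + 3 * K) * (2 + 3 * K) * (1 + 3 * K) * C₀              ∎
      where open ≡-Reasoning

  p₀ p₁ p₂ : ℤ → ℤ
  p₀ N = 64 * (1 + N) * (1 + N) * (1 + N)
  p₁ N = - (2 * (3 + 2 * N) * (12 + 15 * N + 5 * N * N))
  p₂ N = (2 + N) * (2 + N) * (2 + N)

  open SecondOrderRecurrence p₀ p₁ p₂ public

  rightSummand : ℕ → ℕ → ℕ
  rightSummand n k = ((2 ℕ.* k) C k) ℕ.* ((2 ℕ.* n ∸ 2 ℕ.* k) C (n ∸ k)) ℕ.* (n C k) ^ 2

  right : ℕ → ℕ → ℤ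
  right n k = + rightSummand n k

  right≡central*central*binom² : ∀ n k → right n k ≡ central k * central (n ∸ k) * (binom n k * binom n k)
  right≡central*central*binom² n k = begin
    + (x ℕ.* y ℕ.* z ^ 2)             ≡⟨ pos-* (x ℕ.* y) (z ^ 2) ⟩
    + (x ℕ.* y) * + (z ^ 2)           ≡⟨ cong₂ _*_ (pos-* x y) (trans (cong (λ t → + (z ℕ.* t)) (ℕ.*-identityʳ z)) (pos-* z z)) ⟩
    + x * + y * (+ z * + z)           ≡⟨ cong (λ m → + x * + (m C (n ∸ k)) * (+ z * + z)) (sym (ℕ.*-distribˡ-∸ 2 n k)) ⟩
    central k * central (n ∸ k) * (binom n k * binom n k) ∎
    where
    open ≡-Reasoning
    x = (2 ℕ.* k) C k
    y = (2 ℕ.* n ∸ 2 ℕ.* k) C (n ∸ k)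
    z = n C k

  right-vanishes : ∀ n k → n < k → right n k ≡ 0ℤ
  right-vanishes n k n<k = cong +_ (begin
    rightSummand n k                                         ≡⟨ cong (λ z → x ℕ.* z ^ 2) (k>n⇒nCk≡0 n<k) ⟩
    x ℕ.* 0 ^ 2                                              ≡⟨ ℕ.*-zeroʳ x ⟩
    0                                                        ∎)
    where
    open ≡-Reasoning
    x = ((2 ℕ.* k) C k) ℕ.* ((2 ℕ.* n ∸ 2 ℕ.* k) C (n ∸ k))

  aR bR : ℤ → ℤ → ℤ
  aR N K = 2 * (1 + 2 * N - 2 * K) * ((1 + N) * (1 + N))
  bR N K = (1 + N - K) * (1 + N - K) * (1 + N - K)

  right-shiftₙ : ∀ n k → aR (+ n) (+ k) * right n k ≡ bR (+ n) (+ k) * right (suc n) k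
  right-shiftₙ n k with ℕ.<-cmp k (suc n)
  ... | tri< (s≤s k≤n) _ _ = begin
    a * right n k
      ≡⟨ cong (a *_) (right≡central*central*binom² n k) ⟩
    a * (central k * central (n ∸ k) * (binom n k * binom n k))
      ≡⟨ combine (+ n) (+ k) {X = central k} +[n∸k]≡n-k (central-suc (n ∸ k)) (binom-suc-upper n k) ⟩
    b * (central k * central (suc (n ∸ k)) * (binom (suc n) k * binom (suc n) k))
      ≡⟨ cong (λ j → b * (central k * central j * (binom (suc n) k * binom (suc n) k))) (sym (ℕ.+-∸-assoc 1 k≤n)) ⟩
    b * (central k * central (suc n ∸ k) * (binom (suc n) k * binom (suc n) k))
      ≡⟨ cong (b *_) (sym (right≡central*central*binom² (suc n) k)) ⟩
    b * right (suc n) k ∎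
    where
    open ≡-Reasoning
    a = aR (+ n) (+ k)
    b = bR (+ n) (+ k)
    +[n∸k]≡n-k : + (n ∸ k) ≡ + n - + k
    +[n∸k]≡n-k = trans (sym (⊖-≥ k≤n)) (sym (m-n≡m⊖n n k))
    combine : ∀ N K {J X Y₁ Y Z₁ Z} → J ≡ N - K → (1 + J) * Y₁ ≡ 2 * (1 + 2 * J) * Y →
              (1 + N - K) * Z₁ ≡ (1 + N) * Z →
              2 * (1 + 2 * N - 2 * K) * ((1 + N) * (1 + N)) * (X * Y * (Z * Z))
                ≡ (1 + N - K) * (1 + N - K) * (1 + N - K) * (X * Y₁ * (Z₁ * Z₁))
    combine N K {X = X} {Y₁} {Y} {Z₁} {Z} refl h₁ h₂ = begin
      2 * (1 + 2 * N - 2 * K) * ((1 + N) * (1 + N)) * (X * Y * (Z * Z))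
        ≡⟨ solve (N ∷ K ∷ X ∷ Y ∷ Z ∷ []) ⟩
      X * (2 * (1 + 2 * (N - K)) * Y) * ((1 + N) * Z) * ((1 + N) * Z)
        ≡⟨ cong₂ (λ u v → X * u * v * v) (sym h₁) (sym h₂) ⟩
      X * ((1 + (N - K)) * Y₁) * ((1 + N - K) * Z₁) * ((1 + N - K) * Z₁)
        ≡⟨ solve (N ∷ K ∷ X ∷ Y₁ ∷ Z₁ ∷ []) ⟩
      (1 + N - K) * (1 + N - K) * (1 + N - K) * (X * Y₁ * (Z₁ * Z₁)) ∎
  ... | tri≈ _ refl _ = vanish-with-coefficient (aR (+ n) (+ suc n)) (right (suc n) (suc n))
    (right-vanishes n (suc n) (ℕ.n<1+n n)) (n-n≡0 (+ n))
    where
    n-n≡0 : ∀ N → (1 + N - (1 + N)) * (1 + N - (1 + N)) * (1 + N - (1 + N)) ≡ 0ℤ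
    n-n≡0 = solve-∀
  ... | tri> _ _ n+1<k = both-vanish (aR (+ n) (+ k)) (bR (+ n) (+ k))
    (right-vanishes n k (ℕ.<-trans (ℕ.n<1+n n) n+1<k)) (right-vanishes (suc n) k n+1<k)

  cR dR : ℤ → ℤ → ℤ
  cR M K = (1 + K) * (1 + K) * (1 + K) * (2 * M - 2 * K - 1)
  dR M K = (1 + 2 * K) * ((M - K) * (M - K) * (M - K))

  right-shiftₖ : ∀ m k → cR (+ m) (+ k) * right m (suc k) ≡ dR (+ m) (+ k) * right m k
  right-shiftₖ m k with ℕ.<-cmp k m
  ... | tri< k<m _ _ = begin
    c * right m (suc k)
      ≡⟨ cong (c *_) (right≡central*central*binom² m (suc k)) ⟩
    c * (central (suc k) * central (m ∸ suc k) * (binom m (suc k) * binom m (suc k)))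
      ≡⟨ combine (+ m) (+ k) +[m∸1+k]≡m-[1+k] (central-suc k) (central-suc (m ∸ suc k)) (binom-suc-lower m k) ⟩
    d * (central k * central (suc (m ∸ suc k)) * (binom m k * binom m k))
      ≡⟨ cong (λ j → d * (central k * central j * (binom m k * binom m k))) (sym (ℕ.+-∸-assoc 1 k<m)) ⟩
    d * (central k * central (m ∸ k) * (binom m k * binom m k))
      ≡⟨ cong (d *_) (sym (right≡central*central*binom² m k)) ⟩
    d * right m k ∎
    where
    open ≡-Reasoning
    c = cR (+ m) (+ k)
    d = dR (+ m) (+ k)
    +[m∸1+k]≡m-[1+k] : + (m ∸ suc k) ≡ + m - (1 + + k)
    +[m∸1+k]≡m-[1+k] = trans (sym (⊖-≥ k<m)) (sym (m-n≡m⊖n m (suc k)))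
    combine : ∀ M K {J X₁ X Yₛ Yₗ Z₁ Z} → J ≡ M - (1 + K) → (1 + K) * X₁ ≡ 2 * (1 + 2 * K) * X →
              (1 + J) * Yₗ ≡ 2 * (1 + 2 * J) * Yₛ → (1 + K) * Z₁ ≡ (M - K) * Z →
              (1 + K) * (1 + K) * (1 + K) * (2 * M - 2 * K - 1) * (X₁ * Yₛ * (Z₁ * Z₁))
                ≡ (1 + 2 * K) * ((M - K) * (M - K) * (M - K)) * (X * Yₗ * (Z * Z))
    combine M K {X₁ = X₁} {X} {Yₛ} {Yₗ} {Z₁} {Z} refl h₁ h₂ h₃ = begin
      (1 + K) * (1 + K) * (1 + K) * (2 * M - 2 * K - 1) * (X₁ * Yₛ * (Z₁ * Z₁))
        ≡⟨ solve (M ∷ K ∷ X₁ ∷ Yₛ ∷ Z₁ ∷ []) ⟩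
      (1 + K) * X₁ * ((1 + K) * Z₁) * ((1 + K) * Z₁) * ((2 * M - 2 * K - 1) * Yₛ)
        ≡⟨ cong₂ (λ u v → u * v * v * ((2 * M - 2 * K - 1) * Yₛ)) h₁ h₃ ⟩
      2 * (1 + 2 * K) * X * ((M - K) * Z) * ((M - K) * Z) * ((2 * M - 2 * K - 1) * Yₛ)
        ≡⟨ solve (M ∷ K ∷ X ∷ Yₛ ∷ Z ∷ []) ⟩
      (1 + 2 * K) * ((M - K) * (M - K)) * (X * (Z * Z)) * (2 * (1 + 2 * (M - (1 + K))) * Yₛ)
        ≡⟨ cong ((1 + 2 * K) * ((M - K) * (M - K)) * (X * (Z * Z)) *_) (sym h₂) ⟩
      (1 + 2 * K) * ((M - K) * (M - K)) * (X * (Z * Z)) * ((1 + (M - (1 + K))) * Yₗ)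
        ≡⟨ solve (M ∷ K ∷ X ∷ Yₗ ∷ Z ∷ []) ⟩
      (1 + 2 * K) * ((M - K) * (M - K) * (M - K)) * (X * Yₗ * (Z * Z)) ∎
  ... | tri≈ _ refl _ = vanish-with-coefficient (cR (+ m) (+ m)) (right m m)
    (right-vanishes m (suc m) (ℕ.n<1+n m)) (m-m≡0 (+ m))
    where
    m-m≡0 : ∀ M → (1 + 2 * M) * ((M - M) * (M - M) * (M - M)) ≡ 0ℤ
    m-m≡0 = solve-∀
  ... | tri> _ _ m<k = both-vanish (cR (+ m) (+ k)) (dR (+ m) (+ k))
    (right-vanishes m (suc k) (ℕ.<-trans m<k (ℕ.n<1+n k))) (right-vanishes m k m<k)

  DR AR l₁R l₂R l₃R : ℤ → ℤ → ℤ
  DR N K = (1 + 2 * (1 + N) - 2 * K) * ((2 + N) * (2 + N))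
  AR N K = K * K * K * (- (2 * (28 + 52 * N + 31 * N * N + 6 * N * N * N)) + (74 + 89 * N + 26 * N * N) * K
                        - 6 * (5 + 3 * N) * K * K + 4 * K * K * K)
  l₁R N K = (1 + K) * (1 + K) * (1 + K)
  l₂R N K = 4 * ((1 + N) * (1 + N))
  l₃R N K = 4 * (1 + 2 * N - 2 * K) * ((1 + N) * (1 + N)) * ((1 + K) * (1 + K) * (1 + K))

  common-multipleR : ∀ N K →
    let a₀ = 2 * (1 + 2 * N - 2 * K) * ((1 + N) * (1 + N))
        a₁ = 2 * (1 + 2 * (1 + N) - 2 * K) * ((1 + (1 + N)) * (1 + (1 + N)))
        c  = (1 + K) * (1 + K) * (1 + K) * (2 * (2 + N) - 2 * K - 1)
        D  = (1 + 2 * (1 + N) - 2 * K) * ((2 + N) * (2 + N))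
        D′ = (1 + 2 * (1 + N) - 2 * (1 + K)) * ((2 + N) * (2 + N))
        l₁ = (1 + K) * (1 + K) * (1 + K)
        l₂ = 4 * ((1 + N) * (1 + N))
        l₃ = 4 * (1 + 2 * N - 2 * K) * ((1 + N) * (1 + N)) * ((1 + K) * (1 + K) * (1 + K))
    in (a₀ * a₁ * l₁ ≡ c * D′ * l₂) × (a₀ * a₁ * l₁ ≡ D * l₃)
  common-multipleR N K = solve (N ∷ K ∷ []) , solve (N ∷ K ∷ [])

  -- The certificate identity, divided by the factor (1 + K)³ shared by all three of its terms.
  certificateR : ∀ N K →
    let p₀ = 64 * (1 + N) * (1 + N) * (1 + N)
        p₁ = - (2 * (3 + 2 * N) * (12 + 15 * N + 5 * N * N))
        p₂ = (2 + N) * (2 + N) * (2 + N)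
        a₀ = 2 * (1 + 2 * N - 2 * K) * ((1 + N) * (1 + N))
        a₁ = 2 * (1 + 2 * (1 + N) - 2 * K) * ((1 + (1 + N)) * (1 + (1 + N)))
        b₀ = (1 + N - K) * (1 + N - K) * (1 + N - K)
        b₁ = (1 + (1 + N) - K) * (1 + (1 + N) - K) * (1 + (1 + N) - K)
        d  = (1 + 2 * K) * ((2 + N - K) * (2 + N - K) * (2 + N - K))
        r₀ = - (2 * (28 + 52 * N + 31 * N * N + 6 * N * N * N))
        r₁ = 74 + 89 * N + 26 * N * N
        r₂ = 6 * (5 + 3 * N)
        A  = K * K * K * (r₀ + r₁ * K - r₂ * K * K + 4 * K * K * K)
        A′ = r₀ + r₁ * (1 + K) - r₂ * (1 + K) * (1 + K) + 4 * (1 + K) * (1 + K) * (1 + K)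
    in 4 * (1 + 2 * N - 2 * K) * ((1 + N) * (1 + N)) * A + (p₀ * b₀ * b₁ + p₁ * a₀ * b₁ + p₂ * a₀ * a₁)
         ≡ 4 * ((1 + N) * (1 + N)) * A′ * d
  certificateR = solve-∀

  1+2N-2K≢0 : ∀ N K → 1 + 2 * N - 2 * K ≢ 0ℤ
  1+2N-2K≢0 N K = subst (_≢ 0ℤ) (1+2[N-K]≡1+2N-2K N K) (odd-≢0 (N - K))
    where
    1+2[N-K]≡1+2N-2K : ∀ N K → 1 + 2 * (N - K) ≡ 1 + 2 * N - 2 * K
    1+2[N-K]≡1+2N-2K = solve-∀

  module RightRowSums = CreativeTelescoping right aR bR cR dR DR AR l₁R l₂R l₃R
    right-shiftₙ right-shiftₖ right-vanishes common-multipleR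
    (λ N K → scale-by ((1 + K) * (1 + K) * (1 + K)) (4 * (1 + 2 * N - 2 * K) * ((1 + N) * (1 + N))) (4 * ((1 + N) * (1 + N)))
               (certificateR N K)) (λ N → refl)
    (λ n k → *-≢0 (*-≢0 (+[1+]≢0 1) (1+2N-2K≢0 (+ n) (+ k))) (*-≢0 (+[1+]≢0 n) (+[1+]≢0 n)))
    (λ n k → *-≢0 (*-≢0 (+[1+]≢0 k) (+[1+]≢0 k)) (+[1+]≢0 k))
    (λ n → *-≢0 (1+2N-2K≢0 (1 + + n) (+ (3 ℕ.+ n))) (*-≢0 (+[1+]≢0 (suc n)) (+[1+]≢0 (suc n))))

  leftSummand : ℕ → ℕ → ℕ
  leftSummand n k = ((2 ℕ.* k) C k) ^ 2 ℕ.* ((3 ℕ.* k) C k) ℕ.* ((n ℕ.+ k) C (3 ℕ.* k)) ℕ.* 4 ^ (n ∸ 2 ℕ.* k)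

  left : ℕ → ℕ → ℤ
  left n k = + leftSummand n k

  α : ℕ → ℤ
  α k = central k * central k * binom (3 ℕ.* k) k

  -- 4 ^ (n ∸ 2k) is a junk value when 2k > n, but then β n k = 0 since n + k < 3k.
  power : ℕ → ℕ → ℤ
  power n k = + (4 ^ (n ∸ 2 ℕ.* k))

  β : ℕ → ℕ → ℤ
  β n k = binom (n ℕ.+ k) (3 ℕ.* k) * power n k

  left≡α*β : ∀ n k → left n k ≡ α k * β n k
  left≡α*β n k = begin
    + (x ^ 2 ℕ.* y ℕ.* z ℕ.* w)         ≡⟨ pos-* (x ^ 2 ℕ.* y ℕ.* z) w ⟩
    + (x ^ 2 ℕ.* y ℕ.* z) * + w         ≡⟨ cong (_* + w) (pos-* (x ^ 2 ℕ.* y) z) ⟩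
    + (x ^ 2 ℕ.* y) * + z * + w         ≡⟨ cong (λ t → t * + z * + w) (pos-* (x ^ 2) y) ⟩
    + (x ^ 2) * + y * + z * + w         ≡⟨ cong (λ t → t * + y * + z * + w) x²≡x*x ⟩
    + x * + x * + y * + z * + w         ≡⟨ *-assoc (+ x * + x * + y) (+ z) (+ w) ⟩
    + x * + x * + y * (+ z * + w)       ∎
    where
    open ≡-Reasoning
    x = (2 ℕ.* k) C k
    y = (3 ℕ.* k) C k
    z = (n ℕ.+ k) C (3 ℕ.* k)
    w = 4 ^ (n ∸ 2 ℕ.* k)
    x²≡x*x : + (x ^ 2) ≡ + x * + x
    x²≡x*x = trans (cong (λ t → + (x ℕ.* t)) (ℕ.*-identityʳ x)) (pos-* x x)

  n+k<3k : ∀ n k → n < 2 ℕ.* k → n ℕ.+ k < 3 ℕ.* k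
  n+k<3k n k n<2k = subst (n ℕ.+ k <_) (ℕ.+-comm (2 ℕ.* k) k) (ℕ.+-monoˡ-< k n<2k)

  β-vanishes : ∀ n k → n < 2 ℕ.* k → β n k ≡ 0ℤ
  β-vanishes n k n<2k = trans (cong (_* power n k) (binom-vanishes (n+k<3k n k n<2k))) (*-zeroˡ (power n k))

  left-vanishes : ∀ n k → n < 2 ℕ.* k → left n k ≡ 0ℤ
  left-vanishes n k n<2k = trans (left≡α*β n k) (trans (cong (α k *_) (β-vanishes n k n<2k)) (*-zeroʳ (α k)))

  β-shiftₙ : ∀ n k → 4 * (1 + + n + + k) * β n k ≡ (1 + + n - 2 * + k) * β (suc n) k
  β-shiftₙ n k with ℕ.<-cmp (2 ℕ.* k) (suc n)
  ... | tri< (s≤s 2k≤n) _ _ = begin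
    4 * (1 + + n + + k) * (binom (n ℕ.+ k) (3 ℕ.* k) * power n k)
      ≡⟨ combine (+ n) (+ k) (pos-* 3 k) (binom-suc-upper (n ℕ.+ k) (3 ℕ.* k)) ⟩
    (1 + + n - 2 * + k) * (binom (suc n ℕ.+ k) (3 ℕ.* k) * (4 * power n k))
      ≡⟨ cong (λ P → (1 + + n - 2 * + k) * (binom (suc n ℕ.+ k) (3 ℕ.* k) * P)) (sym power-suc) ⟩
    (1 + + n - 2 * + k) * (binom (suc n ℕ.+ k) (3 ℕ.* k) * power (suc n) k) ∎
    where
    open ≡-Reasoning
    power-suc : power (suc n) k ≡ 4 * power n k
    power-suc = trans (cong (λ e → + (4 ^ e)) (ℕ.+-∸-assoc 1 2k≤n)) (pos-* 4 (4 ^ (n ∸ 2 ℕ.* k)))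
    combine : ∀ N K {T C C₁ P} → T ≡ 3 * K → (1 + (N + K) - T) * C₁ ≡ (1 + (N + K)) * C →
              4 * (1 + N + K) * (C * P) ≡ (1 + N - 2 * K) * (C₁ * (4 * P))
    combine N K {C = C} {C₁} {P} refl h = begin
      4 * (1 + N + K) * (C * P)                  ≡⟨ solve (N ∷ K ∷ C ∷ P ∷ []) ⟩
      4 * P * ((1 + (N + K)) * C)                ≡⟨ cong (4 * P *_) (sym h) ⟩
      4 * P * ((1 + (N + K) - 3 * K) * C₁)       ≡⟨ solve (N ∷ K ∷ C₁ ∷ P ∷ []) ⟩
      (1 + N - 2 * K) * (C₁ * (4 * P))           ∎
  ... | tri≈ _ 2k≡1+n _ = vanish-with-coefficient (4 * (1 + + n + + k)) (β (suc n) k)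
    (β-vanishes n k (subst (n <_) (sym 2k≡1+n) (ℕ.n<1+n n)))
    (trans (cong (λ t → 1 + + n - t) (trans (sym (pos-* 2 k)) (cong +_ 2k≡1+n))) (1+N-[1+N]≡0 (+ n)))
    where
    1+N-[1+N]≡0 : ∀ N → 1 + N - (1 + N) ≡ 0ℤ
    1+N-[1+N]≡0 = solve-∀
  ... | tri> _ _ 1+n<2k = both-vanish (4 * (1 + + n + + k)) (1 + + n - 2 * + k)
    (β-vanishes n k (ℕ.<-trans (ℕ.n<1+n n) 1+n<2k)) (β-vanishes (suc n) k 1+n<2k)

  α-shift : ∀ k → (1 + + k) * (1 + + k) * ((1 + + k) * (2 + 2 * + k) * (1 + 2 * + k)) * α (suc k)
                ≡ 2 * (1 + 2 * + k) * (2 * (1 + 2 * + k)) * ((3 + 3 * + k) * (2 + 3 * + k) * (1 + 3 * + k)) * α k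
  α-shift k = ratio-* ((1 + + k) * (1 + + k)) (2 * (1 + 2 * + k) * (2 * (1 + 2 * + k)))
                      ((1 + + k) * (2 + 2 * + k) * (1 + 2 * + k)) ((3 + 3 * + k) * (2 + 3 * + k) * (1 + 3 * + k))
                      central²-shift (binom-3k-k-suc k)
    where
    central²-shift : (1 + + k) * (1 + + k) * (central (suc k) * central (suc k))
                   ≡ 2 * (1 + 2 * + k) * (2 * (1 + 2 * + k)) * (central k * central k)
    central²-shift = ratio-* (1 + + k) (2 * (1 + 2 * + k)) (1 + + k) (2 * (1 + 2 * + k)) (central-suc k) (central-suc k)

  m∸n≡2+[m∸[2+n]] : ∀ m n → 2 ℕ.+ n ≤ m → m ∸ n ≡ 2 ℕ.+ (m ∸ (2 ℕ.+ n))
  m∸n≡2+[m∸[2+n]] (suc (suc m)) zero    _         = refl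
  m∸n≡2+[m∸[2+n]] (suc m)       (suc n) (s≤s 2+n≤m) = m∸n≡2+[m∸[2+n]] m n 2+n≤m

  β-shiftₖ : ∀ m k → 16 * (1 + 3 * + k) * (2 + 3 * + k) * (3 + 3 * + k) * β m (suc k)
                   ≡ (1 + + m + + k) * (+ m - 2 * + k) * (+ m - 2 * + k - 1) * β m k
  β-shiftₖ m k = begin
    16 * (1 + 3 * + k) * (2 + 3 * + k) * (3 + 3 * + k) * β m (suc k)
      ≡⟨ cong (16 * (1 + 3 * + k) * (2 + 3 * + k) * (3 + 3 * + k) *_) β[m,1+k]≡C′*P′ ⟩
    16 * (1 + 3 * + k) * (2 + 3 * + k) * (3 + 3 * + k) * (C′ * P′)
      ≡⟨ combine (+ m) (+ k) (pos-* 3 k) (binom-absorption (m ℕ.+ k) (2 ℕ.+ 3 ℕ.* k))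
           (binom-suc-lower (m ℕ.+ k) (suc (3 ℕ.* k))) (binom-suc-lower (m ℕ.+ k) (3 ℕ.* k)) 16*P′*C′≡P*C′ ⟩
    (1 + + m + + k) * (+ m - 2 * + k) * (+ m - 2 * + k - 1) * β m k ∎
    where
    open ≡-Reasoning
    C′ = binom (suc (m ℕ.+ k)) (3 ℕ.+ 3 ℕ.* k)
    P′ = power m (suc k)
    β[m,1+k]≡C′*P′ : β m (suc k) ≡ C′ * P′
    β[m,1+k]≡C′*P′ = cong₂ (λ i j → binom i j * P′) (ℕ.+-suc m k) (ℕ.*-suc 3 k)
    16*P′*C′≡P*C′ : 16 * P′ * C′ ≡ power m k * C′
    16*P′*C′≡P*C′ with (2 ℕ.+ 2 ℕ.* k) ℕ.≤? m
    ... | yes 2+2k≤m = cong (_* C′) (begin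
      16 * + (4 ^ (m ∸ 2 ℕ.* suc k))     ≡⟨ cong (λ j → 16 * + (4 ^ (m ∸ j))) (ℕ.*-suc 2 k) ⟩
      16 * + (4 ^ e)                     ≡⟨ 16x≡4[4x] (+ (4 ^ e)) ⟩
      4 * (4 * + (4 ^ e))                ≡⟨ cong (4 *_) (sym (pos-* 4 (4 ^ e))) ⟩
      4 * + (4 ^ (1 ℕ.+ e))              ≡⟨ sym (pos-* 4 (4 ^ (1 ℕ.+ e))) ⟩
      + (4 ^ (2 ℕ.+ e))                  ≡⟨ cong (λ j → + (4 ^ j)) (sym (m∸n≡2+[m∸[2+n]] m (2 ℕ.* k) 2+2k≤m)) ⟩
      power m k                          ∎)
      where
      e = m ∸ (2 ℕ.+ 2 ℕ.* k)
      16x≡4[4x] : ∀ x → 16 * x ≡ 4 * (4 * x)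
      16x≡4[4x] = solve-∀
    ... | no 2+2k≰m = both-vanish (16 * P′) (power m k) C′≡0 C′≡0
      where
      C′≡0 : C′ ≡ 0ℤ
      C′≡0 = binom-vanishes (s≤s (subst (m ℕ.+ k <_) (cong (2 ℕ.+_) (ℕ.+-comm (2 ℕ.* k) k))
                                         (ℕ.+-monoˡ-< k (ℕ.≰⇒> 2+2k≰m))))
    combine : ∀ M K {T C′ C₂ C₁ C₀ P′ P} → T ≡ 3 * K →
      (1 + (2 + T)) * C′ ≡ (1 + (M + K)) * C₂ → (1 + (1 + T)) * C₂ ≡ (M + K - (1 + T)) * C₁ →
      (1 + T) * C₁ ≡ (M + K - T) * C₀ → 16 * P′ * C′ ≡ P * C′ →
      16 * (1 + 3 * K) * (2 + 3 * K) * (3 + 3 * K) * (C′ * P′) ≡ (1 + M + K) * (M - 2 * K) * (M - 2 * K - 1) * (C₀ * P)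
    combine M K {C′ = C′} {C₂} {C₁} {C₀} {P′} {P} refl h₃ h₂ h₁ hₚ = begin
      16 * (1 + 3 * K) * (2 + 3 * K) * (3 + 3 * K) * (C′ * P′)
        ≡⟨ solve (K ∷ C′ ∷ P′ ∷ []) ⟩
      (1 + 3 * K) * (2 + 3 * K) * (1 + (2 + 3 * K)) * (16 * P′ * C′)
        ≡⟨ cong ((1 + 3 * K) * (2 + 3 * K) * (1 + (2 + 3 * K)) *_) hₚ ⟩
      (1 + 3 * K) * (2 + 3 * K) * (1 + (2 + 3 * K)) * (P * C′)
        ≡⟨ solve (K ∷ C′ ∷ P ∷ []) ⟩
      P * (1 + 3 * K) * (2 + 3 * K) * ((1 + (2 + 3 * K)) * C′)
        ≡⟨ cong (P * (1 + 3 * K) * (2 + 3 * K) *_) h₃ ⟩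
      P * (1 + 3 * K) * (2 + 3 * K) * ((1 + (M + K)) * C₂)
        ≡⟨ solve (M ∷ K ∷ C₂ ∷ P ∷ []) ⟩
      P * (1 + 3 * K) * (1 + (M + K)) * ((1 + (1 + 3 * K)) * C₂)
        ≡⟨ cong (P * (1 + 3 * K) * (1 + (M + K)) *_) h₂ ⟩
      P * (1 + 3 * K) * (1 + (M + K)) * ((M + K - (1 + 3 * K)) * C₁)
        ≡⟨ solve (M ∷ K ∷ C₁ ∷ P ∷ []) ⟩
      P * (1 + (M + K)) * (M + K - (1 + 3 * K)) * ((1 + 3 * K) * C₁)
        ≡⟨ cong (P * (1 + (M + K)) * (M + K - (1 + 3 * K)) *_) h₁ ⟩
      P * (1 + (M + K)) * (M + K - (1 + 3 * K)) * ((M + K - 3 * K) * C₀)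
        ≡⟨ solve (M ∷ K ∷ C₀ ∷ P ∷ []) ⟩
      (1 + M + K) * (M - 2 * K) * (M - 2 * K - 1) * (C₀ * P) ∎

  aL bL cL dL DL AL l₁L l₂L l₃L : ℤ → ℤ → ℤ
  aL N K = 4 * (1 + N + K)
  bL N K = 1 + N - 2 * K
  cL M K = 8 * ((1 + K) * (1 + K) * (1 + K) * (1 + K))
  dL M K = (1 + 2 * K) * (1 + M + K) * (M - 2 * K) * (M - 2 * K - 1)
  DL N K = (1 + N + K) * (2 + N + K)
  AL N K = - (12 * (4 + 3 * N)) * (K * K * K * K)
  l₁L N K = (3 + N + K) * ((1 + K) * (1 + K) * (1 + K) * (1 + K))
  l₂L N K = 2 * (1 + N + K)
  l₃L N K = 16 * l₁L N K

  left-shiftₙ : ∀ n k → aL (+ n) (+ k) * left n k ≡ bL (+ n) (+ k) * left (suc n) k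
  left-shiftₙ n k =
    subst₂ (λ x y → aL (+ n) (+ k) * x ≡ bL (+ n) (+ k) * y) (sym (left≡α*β n k)) (sym (left≡α*β (suc n) k))
    (common-factor (α k) (aL (+ n) (+ k)) (bL (+ n) (+ k)) (β-shiftₙ n k))

  left-shiftₖ : ∀ m k → cL (+ m) (+ k) * left m (suc k) ≡ dL (+ m) (+ k) * left m k
  left-shiftₖ m k = *-cancelˡ-≢0 _ X≢0 $
    subst₂ (λ x y → X * (cL (+ m) (+ k) * x) ≡ X * (dL (+ m) (+ k) * y)) (sym (left≡α*β m (suc k))) (sym (left≡α*β m k))
      (combine (+ m) (+ k) (α-shift k) (β-shiftₖ m k))
    where
    X = 4 * (1 + 2 * + k) * (1 + 3 * + k) * (2 + 3 * + k) * (3 + 3 * + k)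
    X≢0 : X ≢ 0ℤ
    X≢0 = *-≢0 (*-≢0 (*-≢0 (*-≢0 (+[1+]≢0 3) (+[1+a]+c*k≢0 0 2 k)) (+[1+a]+c*k≢0 0 3 k)) (+[1+a]+c*k≢0 1 3 k))
               (+[1+a]+c*k≢0 2 3 k)
    combine : ∀ M K {α₁ β₁ α₀ β₀} →
      (1 + K) * (1 + K) * ((1 + K) * (2 + 2 * K) * (1 + 2 * K)) * α₁
        ≡ 2 * (1 + 2 * K) * (2 * (1 + 2 * K)) * ((3 + 3 * K) * (2 + 3 * K) * (1 + 3 * K)) * α₀ →
      16 * (1 + 3 * K) * (2 + 3 * K) * (3 + 3 * K) * β₁ ≡ (1 + M + K) * (M - 2 * K) * (M - 2 * K - 1) * β₀ →
      4 * (1 + 2 * K) * (1 + 3 * K) * (2 + 3 * K) * (3 + 3 * K) * (8 * ((1 + K) * (1 + K) * (1 + K) * (1 + K)) * (α₁ * β₁))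
        ≡ 4 * (1 + 2 * K) * (1 + 3 * K) * (2 + 3 * K) * (3 + 3 * K) * ((1 + 2 * K) * (1 + M + K) * (M - 2 * K) * (M - 2 * K - 1) * (α₀ * β₀))
    combine M K {α₁} {β₁} {α₀} {β₀} hα hβ = begin
      4 * (1 + 2 * K) * (1 + 3 * K) * (2 + 3 * K) * (3 + 3 * K) * (8 * ((1 + K) * (1 + K) * (1 + K) * (1 + K)) * (α₁ * β₁))
        ≡⟨ solve (K ∷ α₁ ∷ β₁ ∷ []) ⟩
      (1 + K) * (1 + K) * ((1 + K) * (2 + 2 * K) * (1 + 2 * K)) * (16 * (1 + 3 * K) * (2 + 3 * K) * (3 + 3 * K)) * (α₁ * β₁)
        ≡⟨ ratio-* ((1 + K) * (1 + K) * ((1 + K) * (2 + 2 * K) * (1 + 2 * K)))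
                   (2 * (1 + 2 * K) * (2 * (1 + 2 * K)) * ((3 + 3 * K) * (2 + 3 * K) * (1 + 3 * K)))
                   (16 * (1 + 3 * K) * (2 + 3 * K) * (3 + 3 * K)) ((1 + M + K) * (M - 2 * K) * (M - 2 * K - 1)) hα hβ ⟩
      (2 * (1 + 2 * K) * (2 * (1 + 2 * K)) * ((3 + 3 * K) * (2 + 3 * K) * (1 + 3 * K))) * ((1 + M + K) * (M - 2 * K) * (M - 2 * K - 1)) * (α₀ * β₀)
        ≡⟨ solve (M ∷ K ∷ α₀ ∷ β₀ ∷ []) ⟩
      4 * (1 + 2 * K) * (1 + 3 * K) * (2 + 3 * K) * (3 + 3 * K) * ((1 + 2 * K) * (1 + M + K) * (M - 2 * K) * (M - 2 * K - 1) * (α₀ * β₀)) ∎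
      where open ≡-Reasoning

  common-multipleL : ∀ N K →
    let a₀ = 4 * (1 + N + K)
        a₁ = 4 * (1 + (1 + N) + K)
        c  = 8 * ((1 + K) * (1 + K) * (1 + K) * (1 + K))
        D  = (1 + N + K) * (2 + N + K)
        D′ = (1 + N + (1 + K)) * (2 + N + (1 + K))
        l₁ = (3 + N + K) * ((1 + K) * (1 + K) * (1 + K) * (1 + K))
        l₂ = 2 * (1 + N + K)
    in (a₀ * a₁ * l₁ ≡ c * D′ * l₂) × (a₀ * a₁ * l₁ ≡ D * (16 * l₁))
  common-multipleL N K = solve (N ∷ K ∷ []) , solve (N ∷ K ∷ [])

  certificateL : ∀ N K →
    let p₀ = 64 * (1 + N) * (1 + N) * (1 + N)
        p₁ = - (2 * (3 + 2 * N) * (12 + 15 * N + 5 * N * N))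
        p₂ = (2 + N) * (2 + N) * (2 + N)
        a₀ = 4 * (1 + N + K)
        a₁ = 4 * (1 + (1 + N) + K)
        b₀ = 1 + N - 2 * K
        b₁ = 1 + (1 + N) - 2 * K
        d  = (1 + 2 * K) * (1 + (2 + N) + K) * (2 + N - 2 * K) * (2 + N - 2 * K - 1)
        A  = - (12 * (4 + 3 * N)) * (K * K * K * K)
        A′ = - (12 * (4 + 3 * N)) * ((1 + K) * (1 + K) * (1 + K) * (1 + K))
        l₁ = (3 + N + K) * ((1 + K) * (1 + K) * (1 + K) * (1 + K))
    in 16 * l₁ * A + l₁ * (p₀ * b₀ * b₁ + p₁ * a₀ * b₁ + p₂ * a₀ * a₁) ≡ 2 * (1 + N + K) * A′ * d
  certificateL = solve-∀

  module LeftRowSums = CreativeTelescoping left aL bL cL dL DL AL l₁L l₂L l₃L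
    left-shiftₙ left-shiftₖ (λ n k n<k → left-vanishes n k (ℕ.<-≤-trans n<k (ℕ.m≤n*m k 2)))
    common-multipleL certificateL (λ N → *-zeroʳ (- (12 * (4 + 3 * N))))
    (λ n k → *-≢0 (+[1+]≢0 3) (+[1+]≢0 (n ℕ.+ k)))
    (λ n k → *-≢0 (+[1+]≢0 (2 ℕ.+ n ℕ.+ k)) (*-≢0 (*-≢0 (*-≢0 (+[1+]≢0 k) (+[1+]≢0 k)) (+[1+]≢0 k)) (+[1+]≢0 k)))
    (λ n → *-≢0 (+[1+]≢0 (n ℕ.+ (3 ℕ.+ n))) (+[1+]≢0 (suc (n ℕ.+ (3 ℕ.+ n)))))

  +sumTo≡psum : ∀ m f → + sumTo m f ≡ psum (suc m) (λ k → + f k)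
  +sumTo≡psum zero    f = refl
  +sumTo≡psum (suc m) f = cong (_+ + f (suc m)) (+sumTo≡psum m f)

  n<2[1+n/2] : ∀ n → n < 2 ℕ.* suc (n / 2)
  n<2[1+n/2] n = subst₂ _<_ (sym (m≡m%n+[m/n]*n n 2)) (2+q*2≡2[1+q] (n / 2)) (ℕ.+-monoˡ-< (n / 2 ℕ.* 2) (m%n<n n 2))
    where
    2+q*2≡2[1+q] : ∀ q → 2 ℕ.+ q ℕ.* 2 ≡ 2 ℕ.* suc q
    2+q*2≡2[1+q] q = trans (cong (2 ℕ.+_) (ℕ.*-comm q 2)) (sym (ℕ.*-suc 2 q))

  psum-half≡rowSum : ∀ n → psum (suc (n / 2)) (left n) ≡ LeftRowSums.rowSum n
  psum-half≡rowSum n = begin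
    psum (suc h) (left n)              ≡⟨ sym (psum-extend (n ∸ h) (suc h) (left n) vanishes-beyond-half) ⟩
    psum ((n ∸ h) ℕ.+ suc h) (left n)  ≡⟨ cong (λ m → psum m (left n)) n∸h+[1+h]≡1+n ⟩
    psum (suc n) (left n)              ∎
    where
    open ≡-Reasoning
    h = n / 2
    vanishes-beyond-half : ∀ i → left n (i ℕ.+ suc h) ≡ 0ℤ
    vanishes-beyond-half i = left-vanishes n (i ℕ.+ suc h)
      (ℕ.<-≤-trans (n<2[1+n/2] n) (ℕ.*-monoʳ-≤ 2 (ℕ.m≤n+m (suc h) i)))
    n∸h+[1+h]≡1+n : (n ∸ h) ℕ.+ suc h ≡ suc n
    n∸h+[1+h]≡1+n = trans (ℕ.+-suc (n ∸ h) h) (cong suc (ℕ.m∸n+n≡m (m/n≤m n 2)))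

  p₂≢0 : ∀ n → p₂ (+ n) ≢ 0ℤ
  p₂≢0 n = *-≢0 (*-≢0 (+[1+]≢0 (suc n)) (+[1+]≢0 (suc n))) (+[1+]≢0 (suc n))

open import Data.Nat using (_+_; _*_)
open import Data.Integer using (+_)
open import Data.Integer.Properties using (+-injective)

lemma3p1 : (n : ℕ) →
    sumTo (n / 2) (λ k → ((2 * k) C k) ^ 2 * ((3 * k) C k) * ((n + k) C (3 * k)) * 4 ^ (n ∸ 2 * k))
      ≡ sumTo n (λ k → ((2 * k) C k) * ((2 * n ∸ 2 * k) C (n ∸ k)) * (n C k) ^ 2)
lemma3p1 n = +-injective (begin
  + sumTo (n / 2) (leftSummand n)   ≡⟨ +sumTo≡psum (n / 2) (leftSummand n) ⟩
  psum (suc (n / 2)) (left n)       ≡⟨ psum-half≡rowSum n ⟩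
  LeftRowSums.rowSum n              ≡⟨ solutions-agree p₂≢0 {LeftRowSums.rowSum} {RightRowSums.rowSum}
                                         LeftRowSums.rowSum-isSolution RightRowSums.rowSum-isSolution refl refl n ⟩
  RightRowSums.rowSum n             ≡⟨ sym (+sumTo≡psum n (rightSummand n)) ⟩
  + sumTo n (rightSummand n)        ∎)
  where open ≡-Reasoning
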